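{- Let $H$ be a fixed graph without self-loops, let $G$ be a graph with a partial twin decomposition $\Pi$, and let $f\colon V(G)\to V(H)$. If $f$ is a proper $H$-coloring of $G$, then the assignment to the variables $\{c_{v,i}\mid v\in V(G), i\in V(H)\}$ given by $c_{v,i}=1\iff f(v)=i$ (and $c_{v,i}=0$ otherwise) satisfies all constraints in $L_\Pi(G)$.
   Context: All graphs are finite, simple and undirected; $N_G(P)=\{v\in V(G)\setminus P \mid v \text{ adjacent to some } u\in P\}$ is the open neighborhood of $P\subseteq V(G)$. Vertices $u,v$ are twins if $N_G[u]=N_G[v]$ (closed neighborhoods); a partial twin decomposition is a partition of $V(G)$ in which any two vertices of the same part are twins. A proper $H$-coloring of $G$ is a map $f\colon V(G)\to V(H)$ with $\{f(u),f(v)\}\in E(H)$ for all $\{u,v\}\in E(G)$. $\Delta(H)$ is the maximum degree of $H$, $\omega(\cdot)$ the clique number, $[n]=\{1,\dots,n\}$. For each $v\in V(G)$, $i\in V(H)$ there is a boolean variable $c_{v,i}$; polynomials are evaluated over the integers modulo $2$. For $P\subseteq V(G)$, the set $L(P,G)$ of polynomial equalities is defined as follows. Let $d=\Delta(H)$. (Type 1) For each $S\subseteq N_G(P)$ with $|S|=d+1$, written $S=\{s_1,\dots,s_{d+1}\}$, and each $X\subseteq V(H)$ with $|X|=d+1$, written $X=\{x_1,\dots,x_{d+1}\}$, let $p_{P,S,X}=\sum_{i_1,\dots,i_d\in[d+1]\text{ pairwise distinct}}\prod_{k=1}^{d} c_{s_{i_k},x_k}$, and add the constraint $p_{P,S,X}\equiv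 0 \pmod 2$. (Type 2) For each $k\in[d]$, each $S=\{s_1,\dots,s_k\}\subseteq N_G(P)$ of size $k$ and each sequence $x_1,\dots,x_k\in V(H)$ (not necessarily distinct), let $Y=\bigcap_{i=1}^k N_H(x_i)$; if $\omega(H[Y])<|P|$, add the constraint $\prod_{i=1}^k c_{s_i,x_i}\equiv 0\pmod 2$. Finally $L_\Pi(G)=\bigcup_{P\in\Pi}L(P,G)$. -}

module Defs where

open import Data.Nat using (ℕ; zero; suc; _⊔_; _+_; _*_; _≤_; _<_)
open import Data.Bool using (Bool; true; false; if_then_else_; _∧_; _∨_; not)
open import Data.Fin using (Fin; inject₁)
open import Data.Fin.Subset using (Subset; _∈_; _∉_)
open import Data.Fin.Subset using (∣_∣) public
open import Data.Vec using (Vec; []; _∷_; lookup; tabulate)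
open import Data.List using (List; []; _∷_; map; concatMap; foldr; allFin)
open import Data.Nat.ListAction using (sum; product)
open import Data.List.Membership.Propositional using () renaming (_∈_ to _∈ₗ_)
open import Data.List.Relation.Unary.AllPairs using (AllPairs)
open import Data.Product using (Σ; ∃; _×_; _,_)
open import Data.Sum using (_⊎_)
open import Data.Empty using (⊥)
open import Data.Nat.DivMod using (_%_)
open import Relation.Binary.PropositionalEquality using (_≡_)
open import Relation.Nullary.Decidable using (⌊_⌋)
open import Data.Fin.Properties using (_≟_)
open import Function.Definitions using (Injective)

record Graph (n : ℕ) : Set where
  field
    adj     : Fin n → Fin n → Bool
    sym     : ∀ u v → adj u v ≡ adj v u
    irrefl  : ∀ v → adj v v ≡ false
open Graph public

allB : ∀ {k} → (Fin k → Bool) → Bool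
allB {k} p = foldr (λ i b → p i ∧ b) true (allFin k)

deg : ∀ {m} → Graph m → Fin m → ℕ
deg {m} H v = sum (map (λ w → if adj H v w then 1 else 0) (allFin m))

Δ : ∀ {m} → Graph m → ℕ
Δ {m} H = foldr (λ v r → deg H v ⊔ r) 0 (allFin m)

allSubsets : (m : ℕ) → List (Subset m)
allSubsets zero    = [] ∷ []
allSubsets (suc m) = concatMap (λ Q → (false ∷ Q) ∷ (true ∷ Q) ∷ []) (allSubsets m)

subsetB : ∀ {m} → Subset m → Subset m → Bool
subsetB Q Y = allB (λ v → not (lookup Q v) ∨ lookup Y v)

isCliqueB : ∀ {m} → Graph m → Subset m → Bool
isCliqueB H Q = allB (λ u → allB (λ v →
  not (lookup Q u ∧ lookup Q v ∧ not ⌊ u ≟ v ⌋) ∨ adj H u v))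

ω[_] : ∀ {m} → Graph m → Subset m → ℕ
ω[_] {m} H Y = foldr (λ Q r →
  (if subsetB Q Y ∧ isCliqueB H Q then ∣ Q ∣ else 0) ⊔ r) 0 (allSubsets m)

commonNbhd : ∀ {m k} → Graph m → (Fin k → Fin m) → Subset m
commonNbhd H x = tabulate (λ y → allB (λ i → adj H (x i) y))

InNbhd : ∀ {n} → Graph n → Subset n → Fin n → Set
InNbhd G P v = v ∉ P × ∃ λ u → u ∈ P × adj G u v ≡ true

InClosedNbhd : ∀ {n} → Graph n → Fin n → Fin n → Set
InClosedNbhd G u w = w ≡ u ⊎ adj G u w ≡ true

Twins : ∀ {n} → Graph n → Fin n → Fin n → Set
Twins G u v = ∀ w → (InClosedNbhd G u w → InClosedNbhd G v w)
                  × (InClosedNbhd G v w → InClosedNbhd G u w)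

Disjoint : ∀ {n} → Subset n → Subset n → Set
Disjoint P Q = ∀ v → v ∈ P → v ∈ Q → ⊥

record PartialTwinDecomposition {n} (G : Graph n) (Π : List (Subset n)) : Set where
  field
    nonempty : ∀ P → P ∈ₗ Π → ∃ λ v → v ∈ P
    disjoint : AllPairs Disjoint Π
    cover    : ∀ v → ∃ λ P → P ∈ₗ Π × v ∈ P
    twins    : ∀ P → P ∈ₗ Π → ∀ u v → u ∈ P → v ∈ P → Twins G u v

ProperColoring : ∀ {n m} → Graph n → Graph m → (Fin n → Fin m) → Set
ProperColoring G H f = ∀ u v → adj G u v ≡ true → adj H (f u) (f v) ≡ true

assignment : ∀ {n m} → (Fin n → Fin m) → Fin n → Fin m → ℕ
assignment f v i = if ⌊ f v ≟ i ⌋ then 1 else 0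

allTuples : (r k : ℕ) → List (Vec (Fin r) k)
allTuples r zero    = [] ∷ []
allTuples r (suc k) = concatMap (λ i → map (i ∷_) (allTuples r k)) (allFin r)

distinctB : ∀ {r k} → Vec (Fin r) k → Bool
distinctB []       = true
distinctB (i ∷ is) = allB (λ j → not ⌊ i ≟ lookup is j ⌋) ∧ distinctB is

prodFin : ∀ {k} → (Fin k → ℕ) → ℕ
prodFin {k} g = product (map g (allFin k))

-- value of p_{P,S,X} = Σ_{i_1..i_d pairwise distinct in [d+1]} Π_{k=1}^d c_{s_{i_k},x_k}
-- for S = {s_1..s_{d+1}}, X = {x_1..x_{d+1}} (indices 1..d+1 ↦ Fin (suc d))
pType1 : ∀ {n m} (d : ℕ) → (Fin n → Fin m → ℕ)
         → (Fin (suc d) → Fin n) → (Fin (suc d) → Fin m) → ℕ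
pType1 d c s x = sum (map (λ t → if distinctB t
                                   then prodFin (λ k → c (s (lookup t k)) (x (inject₁ k)))
                                   else 0)
                          (allTuples (suc d) d))

SatisfiesL : ∀ {n m} → Graph n → Graph m → (Fin n → Fin m → ℕ) → Subset n → Set
SatisfiesL {n} {m} G H c P =
  (∀ (s : Fin (suc (Δ H)) → Fin n) → Injective _≡_ _≡_ s → (∀ i → InNbhd G P (s i))
   → ∀ (x : Fin (suc (Δ H)) → Fin m) → Injective _≡_ _≡_ x
   → pType1 (Δ H) c s x % 2 ≡ 0)
  ×
  (∀ (k : ℕ) → 1 ≤ k → k ≤ Δ H
   → ∀ (s : Fin k → Fin n) → Injective _≡_ _≡_ s → (∀ i → InNbhd G P (s i))
   → ∀ (x : Fin k → Fin m)
   → ω[ H ] (commonNbhd H x) < ∣ P ∣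
   → prodFin (λ i → c (s i) (x i)) % 2 ≡ 0)

SatisfiesLΠ : ∀ {n m} → Graph n → Graph m → List (Subset n) → (Fin n → Fin m → ℕ) → Set
SatisfiesLΠ G H Π c = ∀ P → P ∈ₗ Π → SatisfiesL G H c P

-- Fix a part P of the twin decomposition. Twins in P are pairwise adjacent, and every vertex of P
-- is adjacent to every vertex of N_G(P); so f is injective on P, f(P) is a clique of H, and f(P)
-- lies in the H-neighbourhood of every colour used on N_G(P).
--
-- Type 1. Put y_k = x_k (k ≤ d) and let N_k be the number of s_i with f(s_i) = y_k. Since the y_k
-- are distinct, a nonzero term of p_{P,S,X} forces i_1,…,i_d to be distinct, so the distinctness
-- filter is vacuous and p_{P,S,X} expands to N_1 ⋯ N_d. If every N_k were odd, every y_k would be a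
-- colour f(s_i); all colours f(s_i) are neighbours of the colour of a vertex of P, which has degree
-- at most d, so no f(s_i) avoids {y_1,…,y_d}. Then N_1 + ⋯ + N_d = d + 1, while d odd numbers sum
-- to a number of the parity of d.
--
-- Type 2. A nonzero monomial means f(s_i) = x_i for all i, and then f(P) is a clique of size |P|
-- inside ⋂ N_H(x_i), contradicting ω(H[Y]) < |P|.

module Submission where

open import Defs hiding (sym)
open import Data.Bool using (Bool; true; false; if_then_else_; _∧_; _∨_; not)
open import Data.Bool.Properties using (T-≡)
open import Data.Fin using (Fin; zero; suc; inject₁)
open import Data.Fin.Properties using (_≟_; any?; suc-injective; 0≢1+n; inject₁-injective)
open import Data.Fin.Subset using (Subset; _∈_; _⊆_; inside; outside; _-_; ⊤)
open import Data.Fin.Subset.Properties using (_∈?_; ∣⊤∣≡n; x∈p⇒∣p-x∣<∣p∣; x∈p∧x≢y⇒x∈p-y)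
open import Data.List using (List; []; _∷_; _++_; map; foldr; allFin; concatMap)
open import Data.List.Properties using (map-tabulate; map-cong; map-∘; map-++)
open import Data.List.Membership.Propositional using () renaming (_∈_ to _∈ₗ_)
open import Data.List.Membership.Propositional.Properties using (∈-allFin; ∈-concatMap⁺)
import Data.List.Relation.Unary.Any as Any
open import Data.Nat using (ℕ; zero; suc; _+_; _*_; _%_; _⊔_; _≤_; _<_; z≤n; s≤s; *-1-rawMonoid)
open import Data.Nat.Divisibility
  using (_∣_; _∤_; _∣?_; divides; _∣0; n∣n; ∣1⇒≡1; ∣m∣n⇒∣m+n; ∣m+n∣m⇒∣n; ∣m⇒∣m*n; ∣n⇒∣m*n; n∣m⇒m%n≡0)
import Data.Nat.ListAction as List
open import Data.Nat.ListAction.Properties using (sum-++)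
open import Data.Nat.Properties
  using (+-*-semiring; +-comm; *-zeroʳ; *-distribˡ-+; *-identityˡ; m≤m⊔n; m≤n⊔m; ≤-trans; <⇒≱)
open import Data.Nat.Tactic.RingSolver using (solve-∀)
open import Algebra.Properties.Semiring.Sum +-*-semiring
  using (sum; sum-cong-≗; sum-replicate-zero; ∑-comm; *-distribʳ-sum)
open import Algebra.Definitions.RawMonoid *-1-rawMonoid using () renaming (sum to product)
open import Data.Product using (∃; _×_; _,_; proj₁; proj₂)
open import Data.Sum using (_⊎_; inj₁; inj₂)
open import Data.Vec using (Vec; []; _∷_; lookup; tabulate; here; there)
open import Data.Vec.Properties using (lookup∘tabulate; lookup⇒[]=; []=⇒lookup)
import Data.Vec.Functional as Vector
open import Function using (_∘_)
open import Function.Bundles using (Equivalence)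
open import Function.Definitions using (Injective)
open import Relation.Binary.PropositionalEquality
  using (_≡_; refl; sym; trans; cong; cong₂; subst; subst₂; module ≡-Reasoning)
open import Relation.Nullary using (¬_; yes; no; contradiction)
open import Relation.Nullary.Decidable using (⌊_⌋; _×-dec_; fromWitness; toWitness)

sum-allFin : ∀ {n} (g : Fin n → ℕ) → List.sum (map g (allFin n)) ≡ sum g
sum-allFin {n} g = trans (cong List.sum (map-tabulate (λ i → i) g)) (go n g)
  where
  go : ∀ n (g : Fin n → ℕ) → List.sum (Data.List.tabulate g) ≡ sum g
  go zero    g = refl
  go (suc n) g = cong (g zero +_) (go n (g ∘ suc))

prodFin≡product : ∀ {n} (g : Fin n → ℕ) → prodFin g ≡ product g
prodFin≡product {n} g = trans (cong List.product (map-tabulate (λ i → i) g)) (go n g)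
  where
  go : ∀ n (g : Fin n → ℕ) → List.product (Data.List.tabulate g) ≡ product g
  go zero    g = refl
  go (suc n) g = cong (g zero *_) (go n (g ∘ suc))

sum-ones : ∀ n → sum {n} (λ _ → 1) ≡ n
sum-ones zero    = refl
sum-ones (suc n) = cong suc (sum-ones n)

∣-product : ∀ {d n} (g : Fin n → ℕ) k → d ∣ g k → d ∣ product g
∣-product g zero    d∣gₖ = ∣m⇒∣m*n _ d∣gₖ
∣-product g (suc k) d∣gₖ = ∣n⇒∣m*n (g zero) (∣-product (g ∘ suc) k d∣gₖ)

sum-map-*ˡ : ∀ {A : Set} c (h : A → ℕ) (as : List A) →
             List.sum (map (λ a → c * h a) as) ≡ c * List.sum (map h as)
sum-map-*ˡ c h []       = sym (*-zeroʳ c)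
sum-map-*ˡ c h (a ∷ as) =
  trans (cong (c * h a +_) (sum-map-*ˡ c h as)) (sym (*-distribˡ-+ c (h a) _))

sum-map-concatMap : ∀ {A B : Set} (h : B → ℕ) (g : A → List B) (as : List A) →
                    List.sum (map h (concatMap g as)) ≡ List.sum (map (λ a → List.sum (map h (g a))) as)
sum-map-concatMap h g []       = refl
sum-map-concatMap h g (a ∷ as) = begin
  List.sum (map h (g a ++ concatMap g as))                 ≡⟨ cong List.sum (map-++ h (g a) _) ⟩
  List.sum (map h (g a) ++ map h (concatMap g as))         ≡⟨ sum-++ (map h (g a)) _ ⟩
  List.sum (map h (g a)) + List.sum (map h (concatMap g as)) ≡⟨ cong (List.sum (map h (g a)) +_) (sum-map-concatMap h g as) ⟩
  List.sum (map h (g a)) + List.sum (map (λ a → List.sum (map h (g a))) as) ∎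
  where open ≡-Reasoning

sum-allTuples-product : ∀ {r} d (g : Fin d → Fin r → ℕ) →
  List.sum (map (λ t → product (λ k → g k (lookup t k))) (allTuples r d)) ≡ product (λ k → sum (g k))
sum-allTuples-product         zero    g = refl
sum-allTuples-product {r = r} (suc d) g = begin
  List.sum (map term (concatMap (λ i → map (i ∷_) (allTuples r d)) (allFin r)))
    ≡⟨ sum-map-concatMap term _ (allFin r) ⟩
  List.sum (map (λ i → List.sum (map term (map (i ∷_) (allTuples r d)))) (allFin r))
    ≡⟨ sum-allFin (λ i → List.sum (map term (map (i ∷_) (allTuples r d)))) ⟩
  sum (λ i → List.sum (map term (map (i ∷_) (allTuples r d))))
    ≡⟨ sum-cong-≗ row ⟩
  sum (λ i → g zero i * rest)
    ≡⟨ *-distribʳ-sum rest (g zero) ⟨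
  sum (g zero) * rest ∎
  where
  open ≡-Reasoning
  term : Vec (Fin r) (suc d) → ℕ
  term t = product (λ k → g k (lookup t k))
  term′ : Vec (Fin r) d → ℕ
  term′ t = product (λ k → g (suc k) (lookup t k))
  rest : ℕ
  rest = product (λ k → sum (g (suc k)))
  row : ∀ i → List.sum (map term (map (i ∷_) (allTuples r d))) ≡ g zero i * rest
  row i = begin
    List.sum (map term (map (i ∷_) (allTuples r d)))  ≡⟨ cong List.sum (map-∘ (allTuples r d)) ⟨
    List.sum (map (λ t → g zero i * term′ t) (allTuples r d)) ≡⟨ sum-map-*ˡ (g zero i) term′ (allTuples r d) ⟩
    g zero i * List.sum (map term′ (allTuples r d))   ≡⟨ cong (g zero i *_) (sum-allTuples-product d (g ∘ suc)) ⟩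
    g zero i * rest                                   ∎

2∤⇒2∣suc : ∀ n → 2 ∤ n → 2 ∣ suc n
2∤⇒2∣suc zero          2∤0   = contradiction (2 ∣0) 2∤0
2∤⇒2∣suc (suc zero)    _     = n∣n
2∤⇒2∣suc (suc (suc n)) 2∤2+n = ∣m∣n⇒∣m+n (n∣n {2}) (2∤⇒2∣suc n (2∤2+n ∘ ∣m∣n⇒∣m+n n∣n))

2∣sum+length : ∀ {d} (h : Fin d → ℕ) → (∀ k → 2 ∤ h k) → 2 ∣ sum h + d
2∣sum+length {zero}  h odd = 2 ∣0
2∣sum+length {suc d} h odd = subst (2 ∣_) (regroup (h zero) (sum (h ∘ suc)) d)
  (∣m∣n⇒∣m+n (2∤⇒2∣suc (h zero) (odd zero)) (2∣sum+length (h ∘ suc) (odd ∘ suc)))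
  where
  regroup : ∀ a b d → suc a + (b + d) ≡ a + b + suc d
  regroup = solve-∀

2∤suc[n+n] : ∀ n → 2 ∤ suc (n + n)
2∤suc[n+n] n 2∣ = contradiction
  (∣1⇒≡1 (∣m+n∣m⇒∣n (subst (2 ∣_) (+-comm 1 (n + n)) 2∣) (divides n (double n)))) λ ()
  where
  double : ∀ n → n + n ≡ n * 2
  double = solve-∀

∈-tabulate⁺ : ∀ {m} {b : Fin m → Bool} {w} → b w ≡ true → w ∈ tabulate b
∈-tabulate⁺ {b = b} {w} bw = lookup⇒[]= w _ (trans (lookup∘tabulate b w) bw)

∈-tabulate⁻ : ∀ {m} {b : Fin m → Bool} {w} → w ∈ tabulate b → b w ≡ true
∈-tabulate⁻ {b = b} {w} w∈ = trans (sym (lookup∘tabulate b w)) ([]=⇒lookup w∈)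

injection⇒∣p∣≤∣q∣ : ∀ {n m} {p : Subset n} {q : Subset m} (g : Fin n → Fin m) →
  (∀ {i j} → i ∈ p → j ∈ p → g i ≡ g j → i ≡ j) → (∀ {i} → i ∈ p → g i ∈ q) → ∣ p ∣ ≤ ∣ q ∣
injection⇒∣p∣≤∣q∣ {p = []} g inj into = z≤n
injection⇒∣p∣≤∣q∣ {p = outside ∷ p} g inj into =
  injection⇒∣p∣≤∣q∣ (g ∘ suc) (λ i∈p j∈p e → suc-injective (inj (there i∈p) (there j∈p) e)) (into ∘ there)
injection⇒∣p∣≤∣q∣ {p = inside ∷ p} {q} g inj into =
  ≤-trans (s≤s (injection⇒∣p∣≤∣q∣ {q = q - g zero} (g ∘ suc)
                  (λ i∈p j∈p e → suc-injective (inj (there i∈p) (there j∈p) e))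
                  (λ i∈p → x∈p∧x≢y⇒x∈p-y (into (there i∈p)) (λ e → 0≢1+n (inj here (there i∈p) (sym e))))))
          (x∈p⇒∣p-x∣<∣p∣ (into here))

image : ∀ {n m} → (Fin n → Fin m) → Subset n → Subset m
image f P = tabulate (λ w → ⌊ any? (λ v → v ∈? P ×-dec f v ≟ w) ⌋)

∈-image⁺ : ∀ {n m} {f : Fin n → Fin m} {P v} → v ∈ P → f v ∈ image f P
∈-image⁺ {v = v} v∈P = ∈-tabulate⁺ (Equivalence.to T-≡ (fromWitness (v , v∈P , refl)))

∈-image⁻ : ∀ {n m} {f : Fin n → Fin m} {P w} → w ∈ image f P → ∃ λ v → v ∈ P × f v ≡ w
∈-image⁻ w∈ = toWitness (Equivalence.from T-≡ (∈-tabulate⁻ w∈))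

∷-injective : ∀ {d m} {a : Fin m} {y : Fin d → Fin m} → Injective _≡_ _≡_ y → (∀ k → ¬ a ≡ y k) →
              Injective _≡_ _≡_ (Vector._∷_ a y)
∷-injective y-inj a∉y {zero}  {zero}  _     = refl
∷-injective y-inj a∉y {zero}  {suc k} a≡yₖ  = contradiction a≡yₖ (a∉y k)
∷-injective y-inj a∉y {suc k} {zero}  yₖ≡a  = contradiction (sym yₖ≡a) (a∉y k)
∷-injective y-inj a∉y {suc j} {suc k} yⱼ≡yₖ = cong suc (y-inj yⱼ≡yₖ)

foldr-⊔-upper : ∀ {A : Set} (g : A → ℕ) {a as} → a ∈ₗ as → g a ≤ foldr (λ b r → g b ⊔ r) 0 as
foldr-⊔-upper g {as = b ∷ _} (Any.here refl)  = m≤m⊔n (g b) _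
foldr-⊔-upper g {as = b ∷ _} (Any.there a∈as) = ≤-trans (foldr-⊔-upper g a∈as) (m≤n⊔m (g b) _)

allB-true : ∀ {k} {p : Fin k → Bool} → (∀ i → p i ≡ true) → allB p ≡ true
allB-true {k} {p} all-true = go (allFin k)
  where
  go : ∀ is → foldr (λ i b → p i ∧ b) true is ≡ true
  go []                          = refl
  go (i ∷ is) rewrite all-true i = go is

distinctB-injective : ∀ {r k} (t : Vec (Fin r) k) → Injective _≡_ _≡_ (lookup t) → distinctB t ≡ true
distinctB-injective []       _     = refl
distinctB-injective (i ∷ is) t-inj = cong₂ _∧_ (allB-true fresh) (distinctB-injective is (suc-injective ∘ t-inj))
  where
  fresh : ∀ j → not ⌊ i ≟ lookup is j ⌋ ≡ true
  fresh j with i ≟ lookup is j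
  ... | yes i≡tⱼ = contradiction (t-inj i≡tⱼ) 0≢1+n
  ... | no _     = refl

subsetB-true : ∀ {m} {Q Y : Subset m} → Q ⊆ Y → subsetB Q Y ≡ true
subsetB-true {Q = Q} {Y} Q⊆Y = allB-true included
  where
  included : ∀ v → not (lookup Q v) ∨ lookup Y v ≡ true
  included v with lookup Q v in v∈Q
  ... | false = refl
  ... | true  = []=⇒lookup (Q⊆Y (lookup⇒[]= v Q v∈Q))

IsClique : ∀ {m} → Graph m → Subset m → Set
IsClique H Q = ∀ {u v} → u ∈ Q → v ∈ Q → ¬ u ≡ v → adj H u v ≡ true

isCliqueB-true : ∀ {m} (H : Graph m) {Q} → IsClique H Q → isCliqueB H Q ≡ true
isCliqueB-true H {Q} clique = allB-true λ u → allB-true λ v → adjacent u v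
  where
  adjacent : ∀ u v → not (lookup Q u ∧ lookup Q v ∧ not ⌊ u ≟ v ⌋) ∨ adj H u v ≡ true
  adjacent u v with lookup Q u in u∈Q | lookup Q v in v∈Q | u ≟ v
  ... | false | _     | _      = refl
  ... | true  | false | _      = refl
  ... | true  | true  | yes _  = refl
  ... | true  | true  | no u≢v = clique (lookup⇒[]= u Q u∈Q) (lookup⇒[]= v Q v∈Q) u≢v

allSubsets-complete : ∀ {m} (Q : Subset m) → Q ∈ₗ allSubsets m
allSubsets-complete []      = Any.here refl
allSubsets-complete (b ∷ Q) =
  ∈-concatMap⁺ (λ Q′ → (false ∷ Q′) ∷ (true ∷ Q′) ∷ []) (Any.map (λ { refl → extend b }) (allSubsets-complete Q))
  where
  extend : ∀ b → (b ∷ Q) ∈ₗ (false ∷ Q) ∷ (true ∷ Q) ∷ []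
  extend false = Any.here refl
  extend true  = Any.there (Any.here refl)

clique⇒∣Q∣≤ω : ∀ {m} (H : Graph m) {Q Y} → Q ⊆ Y → IsClique H Q → ∣ Q ∣ ≤ ω[ H ] Y
clique⇒∣Q∣≤ω H {Q} {Y} Q⊆Y clique =
  subst (_≤ ω[ H ] Y) value (foldr-⊔-upper score (allSubsets-complete Q))
  where
  score : Subset _ → ℕ
  score Q′ = if subsetB Q′ Y ∧ isCliqueB H Q′ then ∣ Q′ ∣ else 0
  value : score Q ≡ ∣ Q ∣
  value rewrite subsetB-true Q⊆Y | isCliqueB-true H clique = refl

∈-commonNbhd : ∀ {m k} (H : Graph m) {x : Fin k → Fin m} {w} →
               (∀ i → adj H (x i) w ≡ true) → w ∈ commonNbhd H x
∈-commonNbhd H adjacent = ∈-tabulate⁺ (allB-true adjacent)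

sum-indicator : ∀ {m} (b : Fin m → Bool) → sum (λ w → if b w then 1 else 0) ≡ ∣ tabulate b ∣
sum-indicator {zero}  b = refl
sum-indicator {suc m} b with b zero
... | true  = cong suc (sum-indicator (b ∘ suc))
... | false = sum-indicator (b ∘ suc)

deg≡∣tabulate-adj∣ : ∀ {m} (H : Graph m) a → deg H a ≡ ∣ tabulate (adj H a) ∣
deg≡∣tabulate-adj∣ H a = trans (sum-allFin (λ w → if adj H a w then 1 else 0)) (sum-indicator (adj H a))

deg≤Δ : ∀ {m} (H : Graph m) a → deg H a ≤ Δ H
deg≤Δ H a = foldr-⊔-upper (deg H) (∈-allFin a)

injective-neighbours⇒≤deg : ∀ {m k} (H : Graph m) a (g : Fin k → Fin m) → Injective _≡_ _≡_ g →
                            (∀ i → adj H a (g i) ≡ true) → k ≤ deg H a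
injective-neighbours⇒≤deg {k = k} H a g g-inj neighbour =
  subst₂ _≤_ (∣⊤∣≡n k) (sym (deg≡∣tabulate-adj∣ H a))
    (injection⇒∣p∣≤∣q∣ {p = ⊤} g (λ _ _ → g-inj) (λ {i} _ → ∈-tabulate⁺ (neighbour i)))

-- assignment f v is definitionally δ (f v).
δ : ∀ {m} → Fin m → Fin m → ℕ
δ a b = if ⌊ a ≟ b ⌋ then 1 else 0

δ-≢ : ∀ {m} {a b : Fin m} → ¬ a ≡ b → δ a b ≡ 0
δ-≢ {a = a} {b} a≢b with a ≟ b
... | yes a≡b = contradiction a≡b a≢b
... | no _    = refl

δ-≡ : ∀ {m} {a b : Fin m} → a ≡ b → δ a b ≡ 1
δ-≡ {a = a} {b} a≡b with a ≟ b
... | yes _   = refl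
... | no a≢b  = contradiction a≡b a≢b

multiplicity : ∀ {r m} → (Fin r → Fin m) → Fin m → ℕ
multiplicity v b = sum (λ i → δ (v i) b)

sum-δ-≢ : ∀ {k m} (u v : Fin k → Fin m) → (∀ i → ¬ u i ≡ v i) → sum (λ i → δ (u i) (v i)) ≡ 0
sum-δ-≢ {k} u v u≢v = trans (sum-cong-≗ (λ i → δ-≢ (u≢v i))) (sum-replicate-zero k)

sum-δ-injective : ∀ {d m} {y : Fin d → Fin m} → Injective _≡_ _≡_ y →
                  ∀ {b} j → b ≡ y j → sum (λ k → δ b (y k)) ≡ 1
sum-δ-injective {y = y} y-inj zero b≡y₀ =
  cong₂ _+_ (δ-≡ b≡y₀) (sum-δ-≢ _ (y ∘ suc) (λ k b≡yₖ → 0≢1+n (y-inj (trans (sym b≡y₀) b≡yₖ))))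
sum-δ-injective {y = y} y-inj (suc j) b≡y =
  cong₂ _+_ (δ-≢ (λ b≡y₀ → 0≢1+n (y-inj (trans (sym b≡y₀) b≡y))))
            (sum-δ-injective (suc-injective ∘ y-inj) j b≡y)

product-δ≡0⊎≗ : ∀ {k m} (u v : Fin k → Fin m) → product (λ i → δ (u i) (v i)) ≡ 0 ⊎ (∀ i → u i ≡ v i)
product-δ≡0⊎≗ {zero}  u v = inj₂ λ ()
product-δ≡0⊎≗ {suc k} u v with u zero ≟ v zero
... | no _      = inj₁ refl
... | yes u₀≡v₀ with product-δ≡0⊎≗ (u ∘ suc) (v ∘ suc)
...   | inj₁ rest≡0 = inj₁ (trans (*-identityˡ _) rest≡0)
...   | inj₂ u≗v    = inj₂ λ { zero → u₀≡v₀ ; (suc i) → u≗v i }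

pType1-assignment : ∀ {n m d} (f : Fin n → Fin m) (s : Fin (suc d) → Fin n) (x : Fin (suc d) → Fin m) →
  Injective _≡_ _≡_ x → pType1 d (assignment f) s x ≡ product (λ k → multiplicity (f ∘ s) (x (inject₁ k)))
pType1-assignment {d = d} f s x x-inj = begin
  pType1 d (assignment f) s x
    ≡⟨ cong List.sum (map-cong distinct-irrelevant (allTuples (suc d) d)) ⟩
  List.sum (map (λ t → product (λ k → δ (f (s (lookup t k))) (y k))) (allTuples (suc d) d))
    ≡⟨ sum-allTuples-product d (λ k i → δ (f (s i)) (y k)) ⟩
  product (λ k → multiplicity (f ∘ s) (y k)) ∎
  where
  open ≡-Reasoning
  y : Fin d → Fin _
  y = x ∘ inject₁
  distinct-irrelevant : ∀ t → (if distinctB t then prodFin (λ k → δ (f (s (lookup t k))) (y k)) else 0)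
                              ≡ product (λ k → δ (f (s (lookup t k))) (y k))
  distinct-irrelevant t with distinctB t in distinct
  ... | true  = prodFin≡product (λ k → δ (f (s (lookup t k))) (y k))
  ... | false with product-δ≡0⊎≗ (f ∘ s ∘ lookup t) y
  ...   | inj₁ product≡0 = sym product≡0
  ...   | inj₂ hits      = contradiction (trans (sym distinct) (distinctB-injective t t-inj)) λ ()
    where
    t-inj : Injective _≡_ _≡_ (lookup t)
    t-inj tᵢ≡tⱼ = inject₁-injective (x-inj (trans (sym (hits _)) (trans (cong (f ∘ s) tᵢ≡tⱼ) (hits _))))

product-multiplicities-even : ∀ {m d} (H : Graph m) a → deg H a ≤ d →
  (v : Fin (suc d) → Fin m) → (∀ i → adj H a (v i) ≡ true) →
  (y : Fin d → Fin m) → Injective _≡_ _≡_ y →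
  2 ∣ product (λ k → multiplicity v (y k))
product-multiplicities-even {d = d} H a deg≤d v v-neighbour y y-inj
  with any? (λ k → 2 ∣? multiplicity v (y k))
... | yes (k , even) = ∣-product (λ k → multiplicity v (y k)) k even
... | no no-even     = contradiction (subst (λ t → 2 ∣ t + d) total (2∣sum+length _ odd)) (2∤suc[n+n] d)
  where
  open ≡-Reasoning
  odd : ∀ k → 2 ∤ multiplicity v (y k)
  odd k even = no-even (k , even)
  occurs : ∀ k → ∃ λ i → v i ≡ y k
  occurs k with any? (λ i → v i ≟ y k)
  ... | yes hit  = hit
  ... | no miss  = contradiction
    (subst (2 ∣_) (sym (sum-δ-≢ v (λ _ → y k) (λ i vᵢ≡yₖ → miss (i , vᵢ≡yₖ)))) (2 ∣0)) (odd k)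
  covered : ∀ i → ∃ λ k → v i ≡ y k
  covered i with any? (λ k → v i ≟ y k)
  ... | yes hit  = hit
  ... | no miss  = contradiction
    (injective-neighbours⇒≤deg H a (Vector._∷_ (v i) y) (∷-injective y-inj (λ k → miss ∘ (k ,_))) neighbour)
    (<⇒≱ (s≤s deg≤d))
    where
    neighbour : ∀ k → adj H a (Vector._∷_ (v i) y k) ≡ true
    neighbour zero    = v-neighbour i
    neighbour (suc k) with occurs k
    ... | i′ , vᵢ′≡yₖ = subst (λ w → adj H a w ≡ true) vᵢ′≡yₖ (v-neighbour i′)
  total : sum (λ k → multiplicity v (y k)) ≡ suc d
  total = begin
    sum (λ k → sum (λ i → δ (v i) (y k))) ≡⟨ ∑-comm (λ k i → δ (v i) (y k)) ⟩
    sum (λ i → sum (λ k → δ (v i) (y k))) ≡⟨ sum-cong-≗ (λ i → sum-δ-injective y-inj (proj₁ (covered i)) (proj₂ (covered i))) ⟩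
    sum {suc d} (λ _ → 1)                 ≡⟨ sum-ones (suc d) ⟩
    suc d                                 ∎

TwinSet : ∀ {n} → Graph n → Subset n → Set
TwinSet G P = ∀ u v → u ∈ P → v ∈ P → Twins G u v

twins⇒adjacent : ∀ {n} (G : Graph n) {u v} → Twins G u v → ¬ u ≡ v → adj G u v ≡ true
twins⇒adjacent G {u} {v} twins u≢v with proj₁ (twins u) (inj₁ refl)
... | inj₁ u≡v = contradiction u≡v u≢v
... | inj₂ vu  = trans (Graph.sym G u v) vu

twinSet-adjacent-nbhd : ∀ {n} (G : Graph n) {P u w} → TwinSet G P → u ∈ P → InNbhd G P w → adj G u w ≡ true
twinSet-adjacent-nbhd G {P} twin u∈P (w∉P , u′ , u′∈P , u′w) with proj₁ (twin u′ _ u′∈P u∈P _) (inj₂ u′w)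
... | inj₁ w≡u = contradiction (subst (_∈ P) (sym w≡u) u∈P) w∉P
... | inj₂ uw  = uw

proper⇒≢ : ∀ {n m} (G : Graph n) (H : Graph m) {f} → ProperColoring G H f →
           ∀ {u v} → adj G u v ≡ true → ¬ f u ≡ f v
proper⇒≢ G H {f} proper {u} {v} uv fu≡fv =
  contradiction (trans (sym (irrefl H (f v))) (subst (λ z → adj H z (f v) ≡ true) fu≡fv (proper u v uv))) λ ()

∣P∣≤ω[commonNbhd] : ∀ {n m k} (G : Graph n) (H : Graph m) {P f} → TwinSet G P → ProperColoring G H f →
  {s : Fin k → Fin n} {x : Fin k → Fin m} → (∀ i → InNbhd G P (s i)) → (∀ i → f (s i) ≡ x i) →
  ∣ P ∣ ≤ ω[ H ] (commonNbhd H x)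
∣P∣≤ω[commonNbhd] G H {P} {f} twin proper {s} {x} s∈N fs≗x =
  ≤-trans (injection⇒∣p∣≤∣q∣ f f-inj ∈-image⁺) (clique⇒∣Q∣≤ω H image⊆Y clique)
  where
  f-inj : ∀ {u v} → u ∈ P → v ∈ P → f u ≡ f v → u ≡ v
  f-inj {u} {v} u∈P v∈P fu≡fv with u ≟ v
  ... | yes u≡v = u≡v
  ... | no u≢v  = contradiction fu≡fv (proper⇒≢ G H proper (twins⇒adjacent G (twin u v u∈P v∈P) u≢v))
  image⊆Y : image f P ⊆ commonNbhd H x
  image⊆Y w∈ with ∈-image⁻ w∈
  ... | v , v∈P , refl = ∈-commonNbhd H λ i →
    subst (λ z → adj H z (f v) ≡ true) (fs≗x i)
      (proper (s i) v (trans (Graph.sym G (s i) v) (twinSet-adjacent-nbhd G twin v∈P (s∈N i))))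
  clique : IsClique H (image f P)
  clique a∈ b∈ a≢b with ∈-image⁻ a∈ | ∈-image⁻ b∈
  ... | u , u∈P , refl | v , v∈P , refl = proper u v (twins⇒adjacent G (twin u v u∈P v∈P) (a≢b ∘ cong f))

satisfiesL : ∀ {n m} (G : Graph n) (H : Graph m) {P f} → TwinSet G P → ProperColoring G H f →
             SatisfiesL G H (assignment f) P
satisfiesL {n} {m} G H {P} {f} twin proper = type1 , type2
  where
  type1 : ∀ (s : Fin (suc (Δ H)) → Fin n) → Injective _≡_ _≡_ s → (∀ i → InNbhd G P (s i)) →
          ∀ (x : Fin (suc (Δ H)) → Fin m) → Injective _≡_ _≡_ x →
          pType1 (Δ H) (assignment f) s x % 2 ≡ 0
  type1 s _ s∈N x x-inj with s∈N zero
  ... | _ , u , u∈P , _ =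
    n∣m⇒m%n≡0 _ 2 (subst (2 ∣_) (sym (pType1-assignment f s x x-inj))
      (product-multiplicities-even H (f u) (deg≤Δ H (f u)) (f ∘ s)
        (λ i → proper u (s i) (twinSet-adjacent-nbhd G twin u∈P (s∈N i)))
        (x ∘ inject₁) (inject₁-injective ∘ x-inj)))
  type2 : ∀ k → 1 ≤ k → k ≤ Δ H → ∀ (s : Fin k → Fin n) → Injective _≡_ _≡_ s → (∀ i → InNbhd G P (s i)) →
          ∀ (x : Fin k → Fin m) → ω[ H ] (commonNbhd H x) < ∣ P ∣ →
          prodFin (λ i → assignment f (s i) (x i)) % 2 ≡ 0
  type2 k _ _ s _ s∈N x ω<∣P∣ with product-δ≡0⊎≗ (f ∘ s) x
  ... | inj₁ product≡0 = cong (_% 2) (trans (prodFin≡product (λ i → assignment f (s i) (x i))) product≡0)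
  ... | inj₂ fs≗x      = contradiction (∣P∣≤ω[commonNbhd] G H twin proper s∈N fs≗x) (<⇒≱ ω<∣P∣)

lemma16 : ∀ {n m} (H : Graph m) (G : Graph n) (Π : List (Subset n))
            → PartialTwinDecomposition G Π
            → (f : Fin n → Fin m)
            → ProperColoring G H f
            → SatisfiesLΠ G H Π (assignment f)
lemma16 H G Π decomposition f proper P P∈Π =
  satisfiesL G H (PartialTwinDecomposition.twins decomposition P P∈Π) proper
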